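{- Let $(\hat H,\hat s,\hat t)$ be a two-rooted graph such that $\hat H$ is a tree and the limit graph $G(\hat H,\hat s,\hat t)$ is finite. Then every tree that confines $(\hat H,\hat s,\hat t)$ contains an induced subgraph isomorphic to $G(\hat H,\hat s,\hat t)$.
   Context: Graphs are simple and undirected. A two-rooted graph is a triple $(H,s,t)$ with $H$ a finite graph and $s,t\in V(H)$ not necessarily distinct. A copy of $(\hat H,\hat s,\hat t)$ in a graph $G$ is $(H,s,t)$ with $H$ an induced subgraph of $G$ and an isomorphism $\hat H\to H$ mapping $\hat s\mapsto s$, $\hat t\mapsto t$. An extension of such a copy in $G$ is $(H',s',t')$ with $H'$ an induced subgraph of $G$, $V(H')=V(H)\cup\{s',t'\}$, $s'\ne t'$ not in $V(H)$, $H'-\{s',t'\}=H$, and $s$ (resp. $t$) the unique neighbour of $s'$ (resp. $t'$) in $H'$; it is closable if there is an induced $s',t'$-path in $G$ all of whose internal vertices lie outside $N_G[V(H)]$. A copy is avoidable if all its extensions are closable, simplicial if it has none. A finite graph $G$ confines $(\hat H,\hat s,\hat t)$ if $G$ contains an induced subgraph isomorphic to $\hat H$ but no avoidable copy of $(\hat H,\hat s,\hat t)$. Given a simplicial copy $(H,s,t)$ in $G$, a pendant extension (PE) of $G$ with respect to it is any graph obtained from $G$ by adding the minimum number of pendant edges (to new vertices) at $s$ and/or $t$ so that $(H,s,t)$ becomes non-simplicial. A PE-sequence of $(\hat H,\hat s,\hat t)$ is a finite or infinite sequence $(G_i)_{i\ge0}$ with $G_0=\hat H$ where, if $G_i$ contains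 a simplicial copy of $(\hat H,\hat s,\hat t)$, $G_{i+1}$ is a PE of $G_i$ with respect to some simplicial copy, and otherwise the sequence ends at $G_i$. Its limit graph is the union of all $G_i$. A PE-sequence is proper if its limit graph has no simplicial copy of $(\hat H,\hat s,\hat t)$. For connected $\hat H$ all proper PE-sequences have isomorphic limit graphs; this common graph is denoted $G(\hat H,\hat s,\hat t)$. -}

module Defs where

open import Data.Nat using (ℕ; zero; suc; _+_; _<_; _≥_)
open import Data.Fin using (Fin; zero; suc; toℕ; fromℕ; splitAt; _↑ˡ_)
open import Data.Fin.Properties using (_≟_; splitAt-↑ˡ; ↑ˡ-injective)
open import Data.Bool using (Bool; true; false)
open import Data.Sum using (_⊎_; inj₁; inj₂)
open import Data.Product using (Σ; _×_; _,_; ∃)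
open import Relation.Nullary using (¬_; Dec; yes; no)
open import Relation.Nullary.Decidable using (isYes)
open import Relation.Binary.PropositionalEquality using (_≡_; refl; sym; trans)

record Graph : Set where
  field
    size   : ℕ
    adj    : Fin size → Fin size → Bool
    adj-sym    : ∀ u v → adj u v ≡ adj v u
    adj-irrefl : ∀ v → adj v v ≡ false

open Graph public

Vertex : Graph → Set
Vertex G = Fin (size G)

Injective : ∀ {A B : Set} → (A → B) → Set
Injective f = ∀ x y → f x ≡ f y → x ≡ y

record Embedding (H G : Graph) : Set where
  field
    map       : Vertex H → Vertex G
    injective : Injective map
    preserves : ∀ u v → adj G (map u) (map v) ≡ adj H u v

open Embedding public

record InducedPath (G : Graph) (x y : Vertex G) : Set where
  field
    len   : ℕ
    vtx   : Fin (suc len) → Vertex G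
    start : vtx zero ≡ x
    end   : vtx (fromℕ len) ≡ y
    inj   : Injective vtx
    induced : ∀ i j → (adj G (vtx i) (vtx j) ≡ true →
                         (toℕ i ≡ suc (toℕ j) ⊎ toℕ j ≡ suc (toℕ i)))
                    × ((toℕ i ≡ suc (toℕ j) ⊎ toℕ j ≡ suc (toℕ i)) →
                         adj G (vtx i) (vtx j) ≡ true)

record Path (G : Graph) (x y : Vertex G) : Set where
  field
    len   : ℕ
    vtx   : Fin (suc len) → Vertex G
    start : vtx zero ≡ x
    end   : vtx (fromℕ len) ≡ y
    inj   : Injective vtx
    steps : ∀ i j → toℕ j ≡ suc (toℕ i) → adj G (vtx i) (vtx j) ≡ true

Connected : Graph → Set
Connected G = ∀ x y → Path G x y

record Cycle (G : Graph) : Set where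
  field
    len   : ℕ
    len≥3 : len ≥ 3
    vtx   : Fin len → Vertex G
    inj   : Injective vtx
    steps : ∀ i j → (toℕ j ≡ suc (toℕ i) ⊎ (suc (toℕ i) ≡ len × toℕ j ≡ 0)) →
              adj G (vtx i) (vtx j) ≡ true

IsTree : Graph → Set
IsTree G = (size G ≥ 1) × Connected G × ¬ Cycle G

-- Copies of a two-rooted graph (Ĥ, ŝ, t̂) in G.  A copy (H,s,t) is given
-- by an induced embedding e : Ĥ → G;  H is its image, s = e ŝ, t = e t̂.

module _ {Ĥ : Graph} (ŝ t̂ : Vertex Ĥ) {G : Graph} (e : Embedding Ĥ G) where

  InCopy : Vertex G → Set
  InCopy v = ∃ λ h → map e h ≡ v

  InClosedNbhd : Vertex G → Set
  InClosedNbhd v = InCopy v ⊎ (∃ λ h → adj G v (map e h) ≡ true)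

  -- (H', s', t') with V(H') = V(H) ∪ {s',t'} is an extension
  record IsExtension (s' t' : Vertex G) : Set where
    field
      distinct : ¬ (s' ≡ t')
      s'∉H     : ¬ InCopy s'
      t'∉H     : ¬ InCopy t'
      s'≁t'    : adj G s' t' ≡ false
      s'~s     : adj G s' (map e ŝ) ≡ true
      t'~t     : adj G t' (map e t̂) ≡ true
      s'-only  : ∀ h → adj G s' (map e h) ≡ true → h ≡ ŝ
      t'-only  : ∀ h → adj G t' (map e h) ≡ true → h ≡ t̂

  Closable : Vertex G → Vertex G → Set
  Closable s' t' = Σ (InducedPath G s' t') λ P →
    ∀ i → 0 < toℕ i → toℕ i < InducedPath.len P →
      ¬ InClosedNbhd (InducedPath.vtx P i)

  Avoidable : Set
  Avoidable = ∀ s' t' → IsExtension s' t' → Closable s' t'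

  Simplicial : Set
  Simplicial = ∀ s' t' → ¬ IsExtension s' t'

  NonSimplicial : Set
  NonSimplicial = ∃ λ s' → ∃ λ t' → IsExtension s' t'

Confines : {Ĥ : Graph} (ŝ t̂ : Vertex Ĥ) → Graph → Set
Confines {Ĥ} ŝ t̂ G = Embedding Ĥ G × (∀ (e : Embedding Ĥ G) → ¬ Avoidable ŝ t̂ e)

-- Vertex set Fin (n + (a + b)); the old vertices are inject+ of Fin n.

module _ (G : Graph) (s t : Vertex G) (a b : ℕ) where

  private
    n = size G
    V' = Fin n ⊎ (Fin a ⊎ Fin b)

    split : Fin (n + (a + b)) → V'
    split x with splitAt n x
    ... | inj₁ u = inj₁ u
    ... | inj₂ y with splitAt a y
    ...   | inj₁ p = inj₂ (inj₁ p)
    ...   | inj₂ q = inj₂ (inj₂ q)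

    adjP : V' → V' → Bool
    adjP (inj₁ u) (inj₁ v) = adj G u v
    adjP (inj₁ u) (inj₂ (inj₁ _)) = isYes (u ≟ s)
    adjP (inj₁ u) (inj₂ (inj₂ _)) = isYes (u ≟ t)
    adjP (inj₂ (inj₁ _)) (inj₁ v) = isYes (v ≟ s)
    adjP (inj₂ (inj₂ _)) (inj₁ v) = isYes (v ≟ t)
    adjP (inj₂ _) (inj₂ _) = false

    adjP-sym : ∀ x y → adjP x y ≡ adjP y x
    adjP-sym (inj₁ u) (inj₁ v) = adj-sym G u v
    adjP-sym (inj₁ u) (inj₂ (inj₁ _)) = refl
    adjP-sym (inj₁ u) (inj₂ (inj₂ _)) = refl
    adjP-sym (inj₂ (inj₁ _)) (inj₁ v) = refl
    adjP-sym (inj₂ (inj₂ _)) (inj₁ v) = refl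
    adjP-sym (inj₂ (inj₁ _)) (inj₂ (inj₁ _)) = refl
    adjP-sym (inj₂ (inj₁ _)) (inj₂ (inj₂ _)) = refl
    adjP-sym (inj₂ (inj₂ _)) (inj₂ (inj₁ _)) = refl
    adjP-sym (inj₂ (inj₂ _)) (inj₂ (inj₂ _)) = refl

    adjP-irrefl : ∀ x → adjP x x ≡ false
    adjP-irrefl (inj₁ u) = adj-irrefl G u
    adjP-irrefl (inj₂ (inj₁ _)) = refl
    adjP-irrefl (inj₂ (inj₂ _)) = refl

  addPendants : Graph
  addPendants = record
    { size = n + (a + b)
    ; adj = λ x y → adjP (split x) (split y)
    ; adj-sym = λ x y → adjP-sym (split x) (split y)
    ; adj-irrefl = λ x → adjP-irrefl (split x)
    }

  private
    split-old : ∀ u → split (u ↑ˡ (a + b)) ≡ inj₁ u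
    split-old u rewrite splitAt-↑ˡ n u (a + b) = refl

  inclusion : Embedding G addPendants
  inclusion = record
    { map = λ u → u ↑ˡ (a + b)
    ; injective = ↑ˡ-injective (a + b)
    ; preserves = λ u v → pres u v
    }
    where
      pres : ∀ u v → adjP (split (u ↑ˡ (a + b))) (split (v ↑ˡ (a + b))) ≡ adj G u v
      pres u v rewrite split-old u | split-old v = refl

_∘E_ : ∀ {A B C : Graph} → Embedding B C → Embedding A B → Embedding A C
_∘E_ {A} {B} {C} g f = record
  { map = λ x → map g (map f x)
  ; injective = λ x y eq → injective f x y (injective g (map f x) (map f y) eq)
  ; preserves = λ u v → trans (preserves g (map f u) (map f v)) (preserves f u v)
  }

module _ {Ĥ : Graph} (ŝ t̂ : Vertex Ĥ) where

  liftCopy : ∀ {G} (e : Embedding Ĥ G) (a b : ℕ) →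
             Embedding Ĥ (addPendants G (map e ŝ) (map e t̂) a b)
  liftCopy {G} e a b = inclusion G (map e ŝ) (map e t̂) a b ∘E e

  IsPE : ∀ {G} (e : Embedding Ĥ G) (a b : ℕ) → Set
  IsPE e a b =
      NonSimplicial ŝ t̂ (liftCopy e a b)
    × (∀ a' b' → a' + b' < a + b → Simplicial ŝ t̂ (liftCopy e a' b'))

  -- PEReach G : G is a term G_i of some PE-sequence of (Ĥ, ŝ, t̂)
  -- (G_0 = Ĥ, and each G_{i+1} is a PE of G_i w.r.t. a simplicial copy)
  data PEReach : Graph → Set where
    start : PEReach Ĥ
    step  : ∀ {G} → PEReach G → (e : Embedding Ĥ G) → Simplicial ŝ t̂ e →
            (a b : ℕ) → IsPE e a b →
            PEReach (addPendants G (map e ŝ) (map e t̂) a b)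

  -- G has no simplicial copy of (Ĥ, ŝ, t̂), so a PE-sequence ends at G
  NoSimplicialCopy : Graph → Set
  NoSimplicialCopy G = ∀ (e : Embedding Ĥ G) → ¬ Simplicial ŝ t̂ e

-- We embed every term G of the PE-sequence into the tree T with connected image, by induction:
-- the start is a copy of the connected graph Ĥ. In an acyclic graph a vertex outside a connected
-- set S has at most one neighbour in S, and two such vertices are never adjacent. At a step,
-- G⁺ = G with a (resp. b) pendant edges at the roots of a simplicial copy e; the copy f ∘ e in T
-- is not avoidable, so it has an extension (s', t'). A vertex of it inside f(G) pulls back to a
-- pendant of e in G, and pendants of e at both roots would form an extension of e. Using the
-- minimality of a + b, the remaining cases are exactly those where the vertices among s', t'
-- outside f(G), which touch f(G) only at the roots, can be the images of the new pendants.
module Submission where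

open import Defs
open import Data.Nat using (ℕ; zero; suc; _+_; _≤_; _∸_; s≤s; z≤n)
open import Data.Nat.Properties using (suc-injective; ≤-pred; +-∸-assoc; n∸n≡0; ≮⇒≥)
open import Data.Fin using (Fin; zero; suc; toℕ; fromℕ; splitAt; _↑ˡ_; _↑ʳ_; opposite)
open import Data.Fin.Properties
  using (_≟_; any?; all?; toℕ-injective; toℕ-fromℕ; toℕ<n; opposite-prop; opposite-involutive;
         splitAt-↑ˡ; splitAt-↑ʳ; splitAt⁻¹-↑ˡ; splitAt⁻¹-↑ʳ; ↑ʳ-injective)
open import Data.Bool using (true; false)
import Data.Bool.Properties as Bool
open import Data.Sum using (_⊎_; inj₁; inj₂; [_,_]′)
open import Data.Product using (Σ; _×_; _,_; ∃; proj₁; proj₂)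
open import Data.Empty using (⊥; ⊥-elim)
open import Data.Vec.Functional using (_∷_; [])
open import Function using (_∘_; const; case_of_)
open import Function.Bundles using (Equivalence)
open import Relation.Nullary using (¬_; Dec; yes; no)
open import Relation.Nullary.Decidable
  using (isYes; isYes≗does; dec-true; dec-false; toWitness; map′; _×-dec_; _→-dec_; ¬?; decidable-stable)
open import Relation.Unary using (_⊆_; _∪_; ｛_｝)
open import Relation.Binary.PropositionalEquality
  using (_≡_; _≢_; refl; sym; trans; cong; cong₂; subst; subst₂; module ≡-Reasoning)

isYes-true : ∀ {A : Set} (d : Dec A) → A → isYes d ≡ true
isYes-true d a = trans (isYes≗does d) (dec-true d a)

isYes-false : ∀ {A : Set} (d : Dec A) → ¬ A → isYes d ≡ false
isYes-false d ¬a = trans (isYes≗does d) (dec-false d ¬a)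

isYes-sound : ∀ {A : Set} (d : Dec A) → isYes d ≡ true → A
isYes-sound d eq = toWitness (Equivalence.from Bool.T-≡ eq)

Within : (G : Graph) → (Vertex G → Set) → ∀ {x y} → Path G x y → Set
Within G S P = ∀ i → S (Path.vtx P i)

IsConnectedSet : (G : Graph) → (Vertex G → Set) → Set
IsConnectedSet G S = ∀ {x y} → S x → S y → Σ (Path G x y) (Within G S)

OutsideNeighbour : (G : Graph) → (Vertex G → Set) → Vertex G → Set
OutsideNeighbour G S v = ¬ S v × ∃ λ w → S w × adj G v w ≡ true

module _ {G : Graph} where

  trivialPath : (x : Vertex G) → Path G x x
  trivialPath x = record
    { len = 0 ; vtx = const x ; start = refl ; end = refl
    ; inj = λ { zero zero _ → refl } ; steps = λ { zero zero () } }

  cons : ∀ {x y} (v : Vertex G) (P : Path G x y) →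
         (∀ i → Path.vtx P i ≢ v) → adj G v x ≡ true → Path G v y
  cons v P v∉P v~x = record
    { len = suc len ; vtx = v ∷ vtx ; start = refl ; end = end ; inj = inj′ ; steps = steps′ }
    where
      open Path P using (len; vtx; end; inj; steps)
      inj′ : Injective (v ∷ vtx)
      inj′ zero    zero    _  = refl
      inj′ zero    (suc j) eq = ⊥-elim (v∉P j (sym eq))
      inj′ (suc i) zero    eq = ⊥-elim (v∉P i eq)
      inj′ (suc i) (suc j) eq = cong suc (inj i j eq)
      steps′ : ∀ i j → toℕ j ≡ suc (toℕ i) → adj G ((v ∷ vtx) i) ((v ∷ vtx) j) ≡ true
      steps′ zero    (suc zero)    _  = subst (λ w → adj G v w ≡ true) (sym (Path.start P)) v~x
      steps′ (suc i) (suc j)       eq = steps i j (suc-injective eq)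
      steps′ zero    zero          ()
      steps′ zero    (suc (suc _)) ()
      steps′ (suc _) zero          ()

  reverse : ∀ {x y} → Path G x y → Path G y x
  reverse {x} P = record
    { len = len ; vtx = vtx ∘ opposite ; start = end ; end = end′ ; inj = inj′ ; steps = steps′ }
    where
      open Path P using (len; vtx; end; inj; steps)
      open ≡-Reasoning
      end′ : vtx (opposite (fromℕ len)) ≡ x
      end′ = trans (cong vtx (toℕ-injective (begin
        toℕ (opposite (fromℕ len)) ≡⟨ opposite-prop (fromℕ len) ⟩
        len ∸ toℕ (fromℕ len)      ≡⟨ cong (len ∸_) (toℕ-fromℕ len) ⟩
        len ∸ len                  ≡⟨ n∸n≡0 len ⟩
        0                          ∎))) (Path.start P)
      inj′ : Injective (vtx ∘ opposite)
      inj′ i j eq = trans (sym (opposite-involutive i))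
                      (trans (cong opposite (inj _ _ eq)) (opposite-involutive j))
      steps′ : ∀ i j → toℕ j ≡ suc (toℕ i) → adj G (vtx (opposite i)) (vtx (opposite j)) ≡ true
      steps′ i j j≡1+i = trans (adj-sym G _ _) (steps (opposite j) (opposite i) (begin
        toℕ (opposite i)          ≡⟨ opposite-prop i ⟩
        len ∸ toℕ i               ≡⟨ +-∸-assoc 1 i<len ⟩
        suc (len ∸ suc (toℕ i))   ≡⟨ cong (λ k → suc (len ∸ k)) j≡1+i ⟨
        suc (len ∸ toℕ j)         ≡⟨ cong suc (opposite-prop j) ⟨
        suc (toℕ (opposite j))    ∎))
        where
          i<len : suc (toℕ i) ≤ len
          i<len = subst (_≤ len) j≡1+i (≤-pred (toℕ<n j))

  cons-within : ∀ {S : Vertex G → Set} {x y v} (P : Path G x y) → Within G S P →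
                ¬ S v → adj G v x ≡ true → Σ (Path G v y) (Within G (｛ v ｝ ∪ S))
  cons-within {S} P P⊆S v∉S v~x =
    cons _ P (λ i eq → v∉S (subst S eq (P⊆S i))) v~x ,
    λ { zero → inj₁ refl ; (suc i) → inj₂ (P⊆S i) }

  distinct-ends⇒len≥1 : ∀ {x y} → x ≢ y → (P : Path G x y) → 1 ≤ Path.len P
  distinct-ends⇒len≥1 x≢y record { len = zero ; start = x≡ ; end = ≡y } =
    ⊥-elim (x≢y (trans (sym x≡) ≡y))
  distinct-ends⇒len≥1 x≢y record { len = suc _ } = s≤s z≤n

  closePath : ∀ {x y} (P : Path G x y) → 2 ≤ Path.len P → adj G y x ≡ true → Cycle G
  closePath {x} {y} P 2≤len y~x = record
    { len = suc len ; len≥3 = s≤s 2≤len ; vtx = vtx ; inj = inj ; steps = steps′ }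
    where
      open Path P using (len; vtx; inj; steps; end)
      steps′ : ∀ i j → toℕ j ≡ suc (toℕ i) ⊎ (suc (toℕ i) ≡ suc len × toℕ j ≡ 0) →
               adj G (vtx i) (vtx j) ≡ true
      steps′ i j       (inj₁ j≡1+i)      = steps i j j≡1+i
      steps′ i zero    (inj₂ (i≡len , _)) =
        subst₂ (λ u w → adj G u w ≡ true) (sym (trans (cong vtx i≡last) end)) (sym (Path.start P)) y~x
        where
          i≡last : i ≡ fromℕ len
          i≡last = toℕ-injective (trans (suc-injective i≡len) (sym (toℕ-fromℕ len)))
      steps′ i (suc j) (inj₂ (_ , ()))

  insert-⊆ : ∀ {S S' : Vertex G → Set} x → S' x → S ⊆ S' → ｛ x ｝ ∪ S ⊆ S'
  insert-⊆ x x∈S' S⊆S' (inj₁ refl) = x∈S'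
  insert-⊆ x x∈S' S⊆S' (inj₂ v∈S) = S⊆S' v∈S

  path-from-outsideNeighbour : ∀ {S : Vertex G → Set} {x y} → IsConnectedSet G S →
                               OutsideNeighbour G S x → S y → Σ (Path G x y) (Within G (｛ x ｝ ∪ S))
  path-from-outsideNeighbour S-conn (x∉S , w , w∈S , x~w) y∈S =
    let P , P⊆S = S-conn w∈S y∈S in cons-within P P⊆S x∉S x~w

  connectedSet-attach : ∀ {S S' : Vertex G → Set} → IsConnectedSet G S → S ⊆ S' →
                        (∀ {v} → S' v → S v ⊎ OutsideNeighbour G S v) → IsConnectedSet G S'
  connectedSet-attach {S} {S'} S-conn S⊆S' classify {x} {y} x∈S' y∈S'
    with classify x∈S' | classify y∈S'
  ... | inj₁ x∈S | inj₁ y∈S =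
    let P , P⊆ = S-conn x∈S y∈S in P , λ i → S⊆S' (P⊆ i)
  ... | inj₂ x-out | inj₁ y∈S =
    let P , P⊆ = path-from-outsideNeighbour S-conn x-out y∈S
    in P , λ i → insert-⊆ {S} {S'} x x∈S' S⊆S' (P⊆ i)
  ... | inj₁ x∈S | inj₂ y-out =
    let P , P⊆ = path-from-outsideNeighbour S-conn y-out x∈S
    in reverse P , λ i → insert-⊆ {S} {S'} y y∈S' S⊆S' (P⊆ (opposite i))
  ... | inj₂ (x∉S , w , w∈S , x~w) | inj₂ y-out with x ≟ y
  ...   | yes refl = trivialPath x , const x∈S'
  ...   | no x≢y =
    let P , P⊆ = path-from-outsideNeighbour S-conn y-out w∈S
        Q , Q⊆ = cons-within (reverse P) (λ i → P⊆ (opposite i)) [ x≢y ∘ sym , x∉S ]′ x~w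
    in Q , λ i → insert-⊆ {｛ y ｝ ∪ S} {S'} x x∈S' (insert-⊆ {S} {S'} y y∈S' S⊆S') (Q⊆ i)

  acyclic⇒unique-neighbour : ¬ Cycle G → ∀ {S : Vertex G → Set} {v w₁ w₂} → IsConnectedSet G S →
                             ¬ S v → S w₁ → S w₂ → adj G v w₁ ≡ true → adj G v w₂ ≡ true → w₁ ≡ w₂
  acyclic⇒unique-neighbour acyclic {S} {v} {w₁} {w₂} S-conn v∉S w₁∈S w₂∈S v~w₁ v~w₂
    with w₁ ≟ w₂
  ... | yes w₁≡w₂ = w₁≡w₂
  ... | no w₁≢w₂ =
    let P , P⊆S = S-conn w₁∈S w₂∈S
        Q , _ = cons-within P P⊆S v∉S v~w₁
    in ⊥-elim (acyclic (closePath Q (s≤s (distinct-ends⇒len≥1 w₁≢w₂ P))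
                                    (trans (adj-sym G _ _) v~w₂)))

  acyclic⇒outsideNeighbours-nonadjacent : ¬ Cycle G → ∀ {S : Vertex G → Set} {x y} →
    IsConnectedSet G S → OutsideNeighbour G S x → OutsideNeighbour G S y → adj G x y ≡ false
  acyclic⇒outsideNeighbours-nonadjacent acyclic {S} {x} {y} S-conn x-out@(x∉S , _) (y∉S , w , w∈S , y~w) =
    Bool.¬-not λ x~y →
      let x≢y : x ≢ y
          x≢y = λ { refl → Bool.not-¬ (adj-irrefl G x) x~y }
          x≡w = acyclic⇒unique-neighbour acyclic
                  (connectedSet-attach S-conn inj₂ inj₂-or-out) [ x≢y , y∉S ]′
                  (inj₁ refl) (inj₂ w∈S) (trans (adj-sym G _ _) x~y) y~w
      in x∉S (subst S (sym x≡w) w∈S)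
    where
      inj₂-or-out : ∀ {v} → (｛ x ｝ ∪ S) v → S v ⊎ OutsideNeighbour G S v
      inj₂-or-out (inj₁ refl) = inj₂ x-out
      inj₂-or-out (inj₂ v∈S) = inj₁ v∈S

pair-injective : ∀ {A : Set} {p q : A} → p ≢ q → Injective (p ∷ q ∷ [])
pair-injective p≢q zero       zero       _  = refl
pair-injective p≢q zero       (suc zero) eq = ⊥-elim (p≢q eq)
pair-injective p≢q (suc zero) zero       eq = ⊥-elim (p≢q (sym eq))
pair-injective p≢q (suc zero) (suc zero) _  = refl

pair-independent : ∀ G {p q} → adj G p q ≡ false →
                   ∀ i j → adj G ((p ∷ q ∷ []) i) ((p ∷ q ∷ []) j) ≡ false
pair-independent G {p} {q} p≁q zero       zero       = adj-irrefl G p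
pair-independent G {p} {q} p≁q zero       (suc zero) = p≁q
pair-independent G {p} {q} p≁q (suc zero) zero       = trans (adj-sym G q p) p≁q
pair-independent G {p} {q} p≁q (suc zero) (suc zero) = adj-irrefl G q

Image : ∀ {H G} → Embedding H G → Vertex G → Set
Image g v = ∃ λ u → map g u ≡ v

mapPath : ∀ {H G} (g : Embedding H G) {x y} → Path H x y → Path G (map g x) (map g y)
mapPath g P = record
  { len = len ; vtx = map g ∘ vtx ; start = cong (map g) (Path.start P) ; end = cong (map g) end
  ; inj = λ i j eq → inj i j (injective g _ _ eq)
  ; steps = λ i j j≡1+i → trans (preserves g _ _) (steps i j j≡1+i) }
  where open Path P using (len; vtx; end; inj; steps)

connectedSet-image : ∀ {H G} → Connected H → (g : Embedding H G) → IsConnectedSet G (Image g)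
connectedSet-image H-connected g (u , refl) (w , refl) = mapPath g (H-connected u w) , λ i → _ , refl

record PendantAt {Ĥ G : Graph} (e : Embedding Ĥ G) (r : Vertex Ĥ) (x : Vertex G) : Set where
  field
    outside  : ¬ Image e x
    adjacent : adj G x (map e r) ≡ true
    only     : ∀ h → adj G x (map e h) ≡ true → h ≡ r

open PendantAt

pendantAt⇒outsideNeighbour : ∀ {Ĥ G} {e : Embedding Ĥ G} {r x} →
                             PendantAt e r x → OutsideNeighbour G (Image e) x
pendantAt⇒outsideNeighbour {e = e} {r} X = outside X , map e r , (r , refl) , adjacent X

module _ {Ĥ G : Graph} {ŝ t̂ : Vertex Ĥ} {e : Embedding Ĥ G} where

  extension : ∀ {x y} → PendantAt e ŝ x → PendantAt e t̂ y → x ≢ y → adj G x y ≡ false →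
              IsExtension ŝ t̂ e x y
  extension X Y x≢y x≁y = record
    { distinct = x≢y ; s'∉H = outside X ; t'∉H = outside Y ; s'≁t' = x≁y
    ; s'~s = adjacent X ; t'~t = adjacent Y ; s'-only = only X ; t'-only = only Y }

  extension-s : ∀ {x y} → IsExtension ŝ t̂ e x y → PendantAt e ŝ x
  extension-s E = record { outside = s'∉H ; adjacent = s'~s ; only = s'-only }
    where open IsExtension E

  extension-t : ∀ {x y} → IsExtension ŝ t̂ e x y → PendantAt e t̂ y
  extension-t E = record { outside = t'∉H ; adjacent = t'~t ; only = t'-only }
    where open IsExtension E

module _ {Ĥ G K : Graph} {e : Embedding Ĥ G} (g : Embedding G K) where

  pendantAt-map : ∀ {r x} → PendantAt e r x → PendantAt (g ∘E e) r (map g x)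
  pendantAt-map X = record
    { outside = λ (h , eq) → outside X (h , injective g _ _ eq)
    ; adjacent = trans (preserves g _ _) (adjacent X)
    ; only = λ h x~h → only X h (trans (sym (preserves g _ _)) x~h) }

  pendantAt-unmap : ∀ {r x} → PendantAt (g ∘E e) r (map g x) → PendantAt e r x
  pendantAt-unmap X = record
    { outside = λ (h , eq) → outside X (h , cong (map g) eq)
    ; adjacent = trans (sym (preserves g _ _)) (adjacent X)
    ; only = λ h x~h → only X h (trans (preserves g _ _) x~h) }

  extension-unmap : ∀ {ŝ t̂ x y} → IsExtension ŝ t̂ (g ∘E e) (map g x) (map g y) →
                    IsExtension ŝ t̂ e x y
  extension-unmap {x = x} {y} E =
    extension (pendantAt-unmap (extension-s E)) (pendantAt-unmap (extension-t E))
              (IsExtension.distinct E ∘ cong (map g)) (trans (sym (preserves g x y)) (IsExtension.s'≁t' E))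

pendantAt? : ∀ {Ĥ G} (e : Embedding Ĥ G) r x → Dec (PendantAt e r x)
pendantAt? {G = G} e r x = map′
  (λ (x∉e , x~r , only-r) → record { outside = x∉e ; adjacent = x~r ; only = only-r })
  (λ X → outside X , adjacent X , only X)
  (¬? (any? λ h → map e h ≟ x) ×-dec adj G x (map e r) Bool.≟ true
    ×-dec all? λ h → (adj G x (map e h) Bool.≟ true) →-dec (h ≟ r))

module _ {Ĥ G : Graph} {ŝ t̂ : Vertex Ĥ} (e : Embedding Ĥ G) where

  extension? : ∀ x y → Dec (IsExtension ŝ t̂ e x y)
  extension? x y = map′
    (λ (X , Y , x≢y , x≁y) → extension X Y x≢y x≁y)
    (λ E → extension-s E , extension-t E , IsExtension.distinct E , IsExtension.s'≁t' E)
    (pendantAt? e ŝ x ×-dec pendantAt? e t̂ y ×-dec ¬? (x ≟ y) ×-dec adj G x y Bool.≟ false)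

  unavoidable⇒nonSimplicial : ¬ Avoidable ŝ t̂ e → NonSimplicial ŝ t̂ e
  unavoidable⇒nonSimplicial unavoidable =
    decidable-stable (any? λ x → any? λ y → extension? x y)
      λ simplicial → unavoidable λ x y E → ⊥-elim (simplicial (x , y , E))

module Pendants (G : Graph) (s t : Vertex G) (a b : ℕ) where

  G⁺ : Graph
  G⁺ = addPendants G s t a b

  old : Vertex G → Vertex G⁺
  old u = u ↑ˡ (a + b)

  new : Fin (a + b) → Vertex G⁺
  new i = size G ↑ʳ i

  rootOf : Fin a ⊎ Fin b → Vertex G
  rootOf (inj₁ _) = s
  rootOf (inj₂ _) = t

  root : Fin (a + b) → Vertex G
  root i = rootOf (splitAt a i)

  data View : Vertex G⁺ → Set where
    old-view : ∀ u → View (old u)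
    new-view : ∀ i → View (new i)

  view : ∀ x → View x
  view x with splitAt (size G) x in eq
  ... | inj₁ u = subst View (splitAt⁻¹-↑ˡ eq) (old-view u)
  ... | inj₂ i = subst View (splitAt⁻¹-↑ʳ eq) (new-view i)

  new-injective : Injective new
  new-injective = ↑ʳ-injective (size G)

  old≢new : ∀ u i → old u ≢ new i
  old≢new u i eq with trans (sym (splitAt-↑ˡ (size G) u (a + b)))
                            (trans (cong (splitAt (size G)) eq) (splitAt-↑ʳ (size G) (a + b) i))
  ... | ()

  adj-old-old : ∀ u v → adj G⁺ (old u) (old v) ≡ adj G u v
  adj-old-old = preserves (inclusion G s t a b)

  adj-new-old : ∀ i u → adj G⁺ (new i) (old u) ≡ isYes (u ≟ root i)
  adj-new-old i u rewrite splitAt-↑ʳ (size G) (a + b) i | splitAt-↑ˡ (size G) u (a + b)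
    with splitAt a i
  ... | inj₁ _ = refl
  ... | inj₂ _ = refl

  adj-new-new : ∀ i j → adj G⁺ (new i) (new j) ≡ false
  adj-new-new i j rewrite splitAt-↑ʳ (size G) (a + b) i | splitAt-↑ʳ (size G) (a + b) j
    with splitAt a i | splitAt a j
  ... | inj₁ _ | inj₁ _ = refl
  ... | inj₁ _ | inj₂ _ = refl
  ... | inj₂ _ | inj₁ _ = refl
  ... | inj₂ _ | inj₂ _ = refl

  module _ {T : Graph} (f : Embedding G T) (w : Fin (a + b) → Vertex T)
           (w-outside : ∀ i → ¬ Image f (w i))
           (w-adj : ∀ i u → adj T (w i) (map f u) ≡ isYes (u ≟ root i))
           (w-injective : Injective w)
           (w-independent : ∀ i j → adj T (w i) (w j) ≡ false) where

    private
      F : Vertex G⁺ → Vertex T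
      F x = [ map f , w ]′ (splitAt (size G) x)

      F-old : ∀ u → F (old u) ≡ map f u
      F-old u = cong [ map f , w ]′ (splitAt-↑ˡ (size G) u (a + b))

      F-new : ∀ i → F (new i) ≡ w i
      F-new i = cong [ map f , w ]′ (splitAt-↑ʳ (size G) (a + b) i)

      F-preserves : ∀ {x y} → View x → View y → adj T (F x) (F y) ≡ adj G⁺ x y
      F-preserves (old-view u) (old-view v) =
        trans (cong₂ (adj T) (F-old u) (F-old v)) (trans (preserves f u v) (sym (adj-old-old u v)))
      F-preserves (new-view i) (old-view u) =
        trans (cong₂ (adj T) (F-new i) (F-old u)) (trans (w-adj i u) (sym (adj-new-old i u)))
      F-preserves (old-view u) (new-view i) =
        trans (adj-sym T _ _) (trans (F-preserves (new-view i) (old-view u)) (adj-sym G⁺ _ _))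
      F-preserves (new-view i) (new-view j) =
        trans (cong₂ (adj T) (F-new i) (F-new j)) (trans (w-independent i j) (sym (adj-new-new i j)))

      F-injective : ∀ {x y} → View x → View y → F x ≡ F y → x ≡ y
      F-injective (old-view u) (old-view v) eq =
        cong old (injective f u v (trans (sym (F-old u)) (trans eq (F-old v))))
      F-injective (old-view u) (new-view i) eq =
        ⊥-elim (w-outside i (u , trans (sym (F-old u)) (trans eq (F-new i))))
      F-injective (new-view i) (old-view u) eq = sym (F-injective (old-view u) (new-view i) (sym eq))
      F-injective (new-view i) (new-view j) eq =
        cong new (w-injective i j (trans (sym (F-new i)) (trans eq (F-new j))))

    extendEmbedding : Embedding G⁺ T
    extendEmbedding = record
      { map = F
      ; injective = λ x y → F-injective (view x) (view y)
      ; preserves = λ x y → F-preserves (view x) (view y) }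

    extendEmbedding-connected : IsConnectedSet T (Image f) → IsConnectedSet T (Image extendEmbedding)
    extendEmbedding-connected f-connected =
      connectedSet-attach f-connected (λ (u , fu≡v) → old u , trans (F-old u) fu≡v)
                                      (λ { (x , refl) → classify (view x) })
      where
        classify : ∀ {x} → View x → Image f (F x) ⊎ OutsideNeighbour T (Image f) (F x)
        classify (old-view u) = inj₁ (u , sym (F-old u))
        classify (new-view i) rewrite F-new i =
          inj₂ (w-outside i , map f (root i) , (root i , refl) ,
                trans (w-adj i (root i)) (isYes-true (root i ≟ root i) refl))

module _ {Ĥ : Graph} {ŝ t̂ : Vertex Ĥ} {G : Graph} (e : Embedding Ĥ G) where

  private
    module P a b = Pendants G (map e ŝ) (map e t̂) a b

  pendantAt-new : ∀ {a b r i} → P.root a b i ≡ map e r → PendantAt (liftCopy ŝ t̂ e a b) r (P.new a b i)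
  pendantAt-new {a} {b} {r} {i} root≡ = record
    { outside = λ (h , eq) → old≢new (map e h) i eq
    ; adjacent = trans (adj-new-old i (map e r)) (isYes-true (map e r ≟ root i) (sym root≡))
    ; only = λ h i~h → injective e h r
        (trans (isYes-sound (map e h ≟ root i) (trans (sym (adj-new-old i (map e h))) i~h)) root≡) }
    where open Pendants G (map e ŝ) (map e t̂) a b

  pendantAt-new⇒root : ∀ {a b r i} → PendantAt (liftCopy ŝ t̂ e a b) r (P.new a b i) →
                       map e r ≡ P.root a b i
  pendantAt-new⇒root {a} {b} {r} {i} X =
    isYes-sound (map e r ≟ root i) (trans (sym (adj-new-old i (map e r))) (adjacent X))
    where open Pendants G (map e ŝ) (map e t̂) a b

  nonSimplicial-lift₀₀ : NonSimplicial ŝ t̂ (liftCopy ŝ t̂ e 0 0) → NonSimplicial ŝ t̂ e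
  nonSimplicial-lift₀₀ (s' , t' , E) = go (view s') (view t') E
    where
      open Pendants G (map e ŝ) (map e t̂) 0 0
      go : ∀ {x y} → View x → View y → IsExtension ŝ t̂ (liftCopy ŝ t̂ e 0 0) x y →
           NonSimplicial ŝ t̂ e
      go (old-view x) (old-view y) E = x , y , extension-unmap (inclusion G _ _ 0 0) E
      go (new-view ()) _ _
      go (old-view _) (new-view ()) _

  nonSimplicial-lift₁₁ : NonSimplicial ŝ t̂ (liftCopy ŝ t̂ e 1 1)
  nonSimplicial-lift₁₁ =
    new zero , new (suc zero) ,
    extension (pendantAt-new refl) (pendantAt-new refl)
              (λ eq → case new-injective _ _ eq of λ ()) (adj-new-new _ _)
    where open Pendants G (map e ŝ) (map e t̂) 1 1

  pendantAt-s⇒nonSimplicial-lift₀₁ : ∀ {x} → PendantAt e ŝ x →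
                                     NonSimplicial ŝ t̂ (liftCopy ŝ t̂ e 0 1)
  pendantAt-s⇒nonSimplicial-lift₀₁ {x} X =
    old x , new zero ,
    extension (pendantAt-map (inclusion G _ _ 0 1) X) (pendantAt-new refl) (λ eq → old≢new x zero eq)
      (trans (adj-sym G⁺ _ _)
        (trans (adj-new-old zero x) (isYes-false (x ≟ map e t̂) λ eq → outside X (t̂ , sym eq))))
    where open Pendants G (map e ŝ) (map e t̂) 0 1

  pendantAt-t⇒nonSimplicial-lift₁₀ : ∀ {y} → PendantAt e t̂ y →
                                     NonSimplicial ŝ t̂ (liftCopy ŝ t̂ e 1 0)
  pendantAt-t⇒nonSimplicial-lift₁₀ {y} Y =
    new zero , old y ,
    extension (pendantAt-new refl) (pendantAt-map (inclusion G _ _ 1 0) Y) (λ eq → old≢new y zero (sym eq))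
      (trans (adj-new-old zero y) (isYes-false (y ≟ map e ŝ) λ eq → outside Y (ŝ , sym eq)))
    where open Pendants G (map e ŝ) (map e t̂) 1 0

  nonSimplicial-lift-a0⇒pendantAt-t : ∀ {a} → ŝ ≢ t̂ →
                                      NonSimplicial ŝ t̂ (liftCopy ŝ t̂ e a 0) → ∃ (PendantAt e t̂)
  nonSimplicial-lift-a0⇒pendantAt-t {a} ŝ≢t̂ (_ , t' , E) = go (view t') (extension-t E)
    where
      open Pendants G (map e ŝ) (map e t̂) a 0
      rootOf-s : (k : Fin a ⊎ Fin 0) → rootOf k ≡ map e ŝ
      rootOf-s (inj₁ _) = refl
      go : ∀ {y} → View y → PendantAt (liftCopy ŝ t̂ e a 0) t̂ y → ∃ (PendantAt e t̂)
      go (old-view y) Y = y , pendantAt-unmap (inclusion G _ _ a 0) Y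
      go (new-view i) Y =
        ⊥-elim (ŝ≢t̂ (injective e _ _ (sym (trans (pendantAt-new⇒root Y) (rootOf-s (splitAt a i))))))

  nonSimplicial-lift-0b⇒pendantAt-s : ∀ {b} → ŝ ≢ t̂ →
                                      NonSimplicial ŝ t̂ (liftCopy ŝ t̂ e 0 b) → ∃ (PendantAt e ŝ)
  nonSimplicial-lift-0b⇒pendantAt-s {b} ŝ≢t̂ (s' , _ , E) = go (view s') (extension-s E)
    where
      open Pendants G (map e ŝ) (map e t̂) 0 b
      go : ∀ {x} → View x → PendantAt (liftCopy ŝ t̂ e 0 b) ŝ x → ∃ (PendantAt e ŝ)
      go (old-view x) X = x , pendantAt-unmap (inclusion G _ _ 0 b) X
      go (new-view i) X = ⊥-elim (ŝ≢t̂ (injective e _ _ (pendantAt-new⇒root X)))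

  simplicial⇒pe-nonempty : Simplicial ŝ t̂ e → ¬ IsPE ŝ t̂ e 0 0
  simplicial⇒pe-nonempty e-simplicial (lift-nonSimplicial , _) =
    let x , y , E = nonSimplicial-lift₀₀ lift-nonSimplicial in e-simplicial x y E

  pe-minimal : ∀ {a b a' b'} → IsPE ŝ t̂ e a b → NonSimplicial ŝ t̂ (liftCopy ŝ t̂ e a' b') →
               a + b ≤ a' + b'
  pe-minimal (_ , minimal) (s' , t' , E) = ≮⇒≥ λ lt → minimal _ _ lt s' t' E

record ConnectedEmbedding (G T : Graph) : Set where
  field
    embedding : Embedding G T
    connected : IsConnectedSet T (Image embedding)

module PendantStep {Ĥ : Graph} {ŝ t̂ : Vertex Ĥ} (Ĥ-connected : Connected Ĥ)
                   {T : Graph} (T-acyclic : ¬ Cycle T)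
                   (T-unavoidable : ∀ (g : Embedding Ĥ T) → ¬ Avoidable ŝ t̂ g)
                   {G : Graph} (φ : ConnectedEmbedding G T)
                   (e : Embedding Ĥ G) (e-simplicial : Simplicial ŝ t̂ e) where

  open ConnectedEmbedding φ renaming (embedding to f; connected to f-connected)

  FreshNeighbour : Vertex G → Vertex T → Set
  FreshNeighbour r p = ¬ Image f p × adj T p (map f r) ≡ true

  freshNeighbour-adj : ∀ {r p} → FreshNeighbour r p → ∀ u → adj T p (map f u) ≡ isYes (u ≟ r)
  freshNeighbour-adj {r} (p∉f , p~r) u with u ≟ r
  ... | yes refl = p~r
  ... | no u≢r = Bool.¬-not λ p~u →
    u≢r (injective f _ _ (acyclic⇒unique-neighbour T-acyclic f-connected p∉f (u , refl) (r , refl) p~u p~r))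

  pendantAt-image-or-fresh : ∀ {r p} → PendantAt (f ∘E e) r p → Image f p ⊎ FreshNeighbour (map e r) p
  pendantAt-image-or-fresh {p = p} P with any? (λ x → map f x ≟ p)
  ... | yes p∈f = inj₁ p∈f
  ... | no p∉f = inj₂ (p∉f , adjacent P)

  no-pendants-at-both-roots : ∀ {x y} → ŝ ≢ t̂ → PendantAt e ŝ x → PendantAt e t̂ y → ⊥
  no-pendants-at-both-roots {x} {y} ŝ≢t̂ X Y =
    e-simplicial x y (extension X Y (λ { refl → ŝ≢t̂ (only Y ŝ (adjacent X)) }) x≁y)
    where
      x≁y : adj G x y ≡ false
      x≁y = trans (sym (preserves f x y))
        (acyclic⇒outsideNeighbours-nonadjacent T-acyclic (connectedSet-image Ĥ-connected (f ∘E e))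
          (pendantAt⇒outsideNeighbour (pendantAt-map f X)) (pendantAt⇒outsideNeighbour (pendantAt-map f Y)))

  Extended : ℕ → ℕ → Set
  Extended a b = ConnectedEmbedding (addPendants G (map e ŝ) (map e t̂) a b) T

  extendBy : ∀ {a b} (w : Fin (a + b) → Vertex T) →
             (∀ i → FreshNeighbour (Pendants.root G (map e ŝ) (map e t̂) a b i) (w i)) →
             Injective w → (∀ i j → adj T (w i) (w j) ≡ false) → Extended a b
  extendBy {a} {b} w w-fresh w-injective w-independent = record
    { embedding = extendEmbedding f w w-outside w-adj w-injective w-independent
    ; connected = extendEmbedding-connected f w w-outside w-adj w-injective w-independent f-connected }
    where
      open Pendants G (map e ŝ) (map e t̂) a b
      w-outside = proj₁ ∘ w-fresh
      w-adj = λ i → freshNeighbour-adj (w-fresh i)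

  extendBy₁₀ : ∀ {p} → FreshNeighbour (map e ŝ) p → Extended 1 0
  extendBy₁₀ {p} p-fresh =
    extendBy (λ _ → p) (λ { zero → p-fresh }) (λ { zero zero _ → refl }) (λ _ _ → adj-irrefl T p)

  extendBy₀₁ : ∀ {q} → FreshNeighbour (map e t̂) q → Extended 0 1
  extendBy₀₁ {q} q-fresh =
    extendBy (λ _ → q) (λ { zero → q-fresh }) (λ { zero zero _ → refl }) (λ _ _ → adj-irrefl T q)

  extendBy₁₁ : ∀ {p q} → FreshNeighbour (map e ŝ) p → FreshNeighbour (map e t̂) q →
               p ≢ q → adj T p q ≡ false → Extended 1 1
  extendBy₁₁ p-fresh q-fresh p≢q p≁q =
    extendBy (_ ∷ _ ∷ []) (λ { zero → p-fresh ; (suc zero) → q-fresh })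
             (pair-injective p≢q) (pair-independent T p≁q)

  extendBy₂₀ : ∀ {p q} → FreshNeighbour (map e ŝ) p → FreshNeighbour (map e ŝ) q →
               p ≢ q → adj T p q ≡ false → Extended 2 0
  extendBy₂₀ p-fresh q-fresh p≢q p≁q =
    extendBy (_ ∷ _ ∷ []) (λ { zero → p-fresh ; (suc zero) → q-fresh })
             (pair-injective p≢q) (pair-independent T p≁q)

  extendBy₀₂ : ∀ {p q} → FreshNeighbour (map e t̂) p → FreshNeighbour (map e t̂) q →
               p ≢ q → adj T p q ≡ false → Extended 0 2
  extendBy₀₂ p-fresh q-fresh p≢q p≁q =
    extendBy (_ ∷ _ ∷ []) (λ { zero → p-fresh ; (suc zero) → q-fresh })
             (pair-injective p≢q) (pair-independent T p≁q)

  private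
    fresh-at-s : ŝ ≡ t̂ → ∀ {q} → FreshNeighbour (map e t̂) q → FreshNeighbour (map e ŝ) q
    fresh-at-s ŝ≡t̂ {q} = subst (λ h → FreshNeighbour (map e h) q) (sym ŝ≡t̂)

    fresh-at-t : ŝ ≡ t̂ → ∀ {p} → FreshNeighbour (map e ŝ) p → FreshNeighbour (map e t̂) p
    fresh-at-t ŝ≡t̂ {p} = subst (λ h → FreshNeighbour (map e h) p) ŝ≡t̂

  extend-old-fresh : ∀ {a b x q} → PendantAt e ŝ x → FreshNeighbour (map e t̂) q →
                     IsPE ŝ t̂ e a b → a + b ≤ 1 → Extended a b
  extend-old-fresh {0} {0} _ _ pe _ = ⊥-elim (simplicial⇒pe-nonempty e e-simplicial pe)
  extend-old-fresh {0} {1} _ q-fresh _ _ = extendBy₀₁ q-fresh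
  extend-old-fresh {1} {0} X q-fresh (lift-nonSimplicial , _) _ with ŝ ≟ t̂
  ... | yes ŝ≡t̂ = extendBy₁₀ (fresh-at-s ŝ≡t̂ q-fresh)
  ... | no ŝ≢t̂ =
    let _ , Y = nonSimplicial-lift-a0⇒pendantAt-t e ŝ≢t̂ lift-nonSimplicial
    in ⊥-elim (no-pendants-at-both-roots ŝ≢t̂ X Y)
  extend-old-fresh {suc (suc _)} _ _ _ (s≤s ())
  extend-old-fresh {1} {suc _} _ _ _ (s≤s ())
  extend-old-fresh {0} {suc (suc _)} _ _ _ (s≤s ())

  extend-fresh-old : ∀ {a b p y} → FreshNeighbour (map e ŝ) p → PendantAt e t̂ y →
                     IsPE ŝ t̂ e a b → a + b ≤ 1 → Extended a b
  extend-fresh-old {0} {0} _ _ pe _ = ⊥-elim (simplicial⇒pe-nonempty e e-simplicial pe)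
  extend-fresh-old {1} {0} p-fresh _ _ _ = extendBy₁₀ p-fresh
  extend-fresh-old {0} {1} p-fresh Y (lift-nonSimplicial , _) _ with ŝ ≟ t̂
  ... | yes ŝ≡t̂ = extendBy₀₁ (fresh-at-t ŝ≡t̂ p-fresh)
  ... | no ŝ≢t̂ =
    let _ , X = nonSimplicial-lift-0b⇒pendantAt-s e ŝ≢t̂ lift-nonSimplicial
    in ⊥-elim (no-pendants-at-both-roots ŝ≢t̂ X Y)
  extend-fresh-old {suc (suc _)} _ _ _ (s≤s ())
  extend-fresh-old {1} {suc _} _ _ _ (s≤s ())
  extend-fresh-old {0} {suc (suc _)} _ _ _ (s≤s ())

  extend-fresh-fresh : ∀ {a b p q} → FreshNeighbour (map e ŝ) p → FreshNeighbour (map e t̂) q →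
                       p ≢ q → adj T p q ≡ false → IsPE ŝ t̂ e a b → a + b ≤ 2 → Extended a b
  extend-fresh-fresh {0} {0} _ _ _ _ pe _ = ⊥-elim (simplicial⇒pe-nonempty e e-simplicial pe)
  extend-fresh-fresh {1} {0} p-fresh _ _ _ _ _ = extendBy₁₀ p-fresh
  extend-fresh-fresh {0} {1} _ q-fresh _ _ _ _ = extendBy₀₁ q-fresh
  extend-fresh-fresh {1} {1} p-fresh q-fresh p≢q p≁q _ _ = extendBy₁₁ p-fresh q-fresh p≢q p≁q
  extend-fresh-fresh {2} {0} p-fresh q-fresh p≢q p≁q pe _ with ŝ ≟ t̂
  ... | yes ŝ≡t̂ = extendBy₂₀ p-fresh (fresh-at-s ŝ≡t̂ q-fresh) p≢q p≁q
  ... | no ŝ≢t̂ =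
    let _ , Y = nonSimplicial-lift-a0⇒pendantAt-t e ŝ≢t̂ (proj₁ pe)
    in case pe-minimal e pe (pendantAt-t⇒nonSimplicial-lift₁₀ e Y) of λ { (s≤s ()) }
  extend-fresh-fresh {0} {2} p-fresh q-fresh p≢q p≁q pe _ with ŝ ≟ t̂
  ... | yes ŝ≡t̂ = extendBy₀₂ (fresh-at-t ŝ≡t̂ p-fresh) q-fresh p≢q p≁q
  ... | no ŝ≢t̂ =
    let _ , X = nonSimplicial-lift-0b⇒pendantAt-s e ŝ≢t̂ (proj₁ pe)
    in case pe-minimal e pe (pendantAt-s⇒nonSimplicial-lift₀₁ e X) of λ { (s≤s ()) }
  extend-fresh-fresh {suc (suc (suc _))} _ _ _ _ _ (s≤s (s≤s ()))
  extend-fresh-fresh {2} {suc _} _ _ _ _ _ (s≤s (s≤s ()))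
  extend-fresh-fresh {1} {suc (suc _)} _ _ _ _ _ (s≤s (s≤s ()))
  extend-fresh-fresh {0} {suc (suc (suc _))} _ _ _ _ _ (s≤s (s≤s ()))

  extend : ∀ {a b} → IsPE ŝ t̂ e a b → Extended a b
  extend pe with unavoidable⇒nonSimplicial (f ∘E e) (T-unavoidable (f ∘E e))
  ... | s' , t' , E with pendantAt-image-or-fresh (extension-s E) | pendantAt-image-or-fresh (extension-t E)
  ... | inj₁ (x , refl) | inj₁ (y , refl) = ⊥-elim (e-simplicial x y (extension-unmap f E))
  ... | inj₁ (x , refl) | inj₂ q-fresh =
    let X = pendantAt-unmap f (extension-s E)
    in extend-old-fresh X q-fresh pe (pe-minimal e pe (pendantAt-s⇒nonSimplicial-lift₀₁ e X))
  ... | inj₂ p-fresh | inj₁ (y , refl) =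
    let Y = pendantAt-unmap f (extension-t E)
    in extend-fresh-old p-fresh Y pe (pe-minimal e pe (pendantAt-t⇒nonSimplicial-lift₁₀ e Y))
  ... | inj₂ p-fresh | inj₂ q-fresh =
    extend-fresh-fresh p-fresh q-fresh (IsExtension.distinct E) (IsExtension.s'≁t' E) pe
      (pe-minimal e pe (nonSimplicial-lift₁₁ e))

module _ {Ĥ : Graph} {ŝ t̂ : Vertex Ĥ} (Ĥ-connected : Connected Ĥ)
         {T : Graph} (T-acyclic : ¬ Cycle T) (T-confines : Confines {Ĥ} ŝ t̂ T) where

  embed-PEReach : ∀ {G} → PEReach {Ĥ} ŝ t̂ G → ConnectedEmbedding G T
  embed-PEReach start = record
    { embedding = proj₁ T-confines ; connected = connectedSet-image Ĥ-connected (proj₁ T-confines) }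
  embed-PEReach (step G-reach e e-simplicial _ _ pe) =
    PendantStep.extend Ĥ-connected T-acyclic (proj₂ T-confines) (embed-PEReach G-reach) e e-simplicial pe

proposition3p25 : (Ĥ : Graph) (ŝ t̂ : Vertex Ĥ) → IsTree Ĥ →
    (G : Graph) → PEReach {Ĥ} ŝ t̂ G → NoSimplicialCopy {Ĥ} ŝ t̂ G →
    (T : Graph) → IsTree T → Confines {Ĥ} ŝ t̂ T →
    Embedding G T
proposition3p25 Ĥ ŝ t̂ (_ , Ĥ-connected , _) G G-reach _ T (_ , _ , T-acyclic) T-confines =
  ConnectedEmbedding.embedding (embed-PEReach Ĥ-connected T-acyclic T-confines G-reach)
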